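{- Let $Q$ be a starred quiver with set of arrows $\mathrm{Arr}(Q)$ and vertices $\{v_1,\dots,v_n\}\cup\{\star\}$ (a single starred vertex). Then each $u_a$ for $a\in\mathrm{Arr}(Q)$ is a vertex of $\mathrm{Root}(Q)$, and $a\mapsto u_a$ is a bijection between $\mathrm{Arr}(Q)$ and the set of vertices of $\mathrm{Root}(Q)$.
   Context: A quiver $Q$ has normal vertices $v_1,\dots,v_n$ ($n\ge1$), a set of starred vertices, and arrows each going normal-to-normal, normal-to-starred or starred-to-normal (never starred-to-starred); no loops, no repeated arrows, connected underlying graph. It is a starred quiver if it has at least one starred vertex. For each arrow $a$ define $u_a\in\mathbb R^n$: $u_a=e_j-e_i$ if $a:v_i\to v_j$; $u_a=e_j$ if $a:\star\to v_j$; $u_a=-e_i$ if $a:v_i\to\star$. The root polytope is $\mathrm{Root}(Q)=\mathrm{Conv}\{u_a : a\in\mathrm{Arr}(Q)\}\subset\mathbb R^n$.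
   Formalization: The root polytope $\mathrm{Root}(Q)$ and its vertices are taken in ℚ^n rather than ℝ^n, with rational convex weights and extremality tested only against rational points. -}

module Defs where

open import Data.Nat using (ℕ; zero; suc)
open import Data.Fin using (Fin; zero; suc; _≟_)
open import Data.List using (List; length; lookup)
open import Data.List.Relation.Unary.All using (All)
open import Data.List.Relation.Unary.Unique.Propositional using (Unique)
open import Data.List.Membership.Propositional using (_∈_)
open import Data.Product using (_×_; _,_; ∃; Σ)
open import Data.Sum using (_⊎_)
open import Data.Rational using (ℚ; 0ℚ; 1ℚ; _+_; _*_; _-_; -_; _≤_; _<_)
open import Relation.Nullary using (yes; no)
open import Relation.Binary.PropositionalEquality using (_≡_; _≢_)

data QVertex (n : ℕ) : Set where
  normal : Fin n → QVertex n
  star   : QVertex n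

-- An arrow is recorded as a (source , target) pair.
QArrow : ℕ → Set
QArrow n = QVertex n × QVertex n

data Reach {n : ℕ} (as : List (QArrow n)) : QVertex n → QVertex n → Set where
  here : ∀ {x} → Reach as x x
  fwd  : ∀ {x y z} → (x , y) ∈ as → Reach as y z → Reach as x z
  bwd  : ∀ {x y z} → (y , x) ∈ as → Reach as y z → Reach as x z

-- A starred quiver with normal vertices v_1..v_n (n ≥ 1 is imposed in the theorem)
-- and exactly one starred vertex ⋆.
record StarredQuiver (n : ℕ) : Set where
  field
    arrows    : List (QArrow n)
    -- no loops (this also excludes starred-to-starred arrows, there being one star)
    noLoops   : All (λ a → Data.Product.proj₁ a ≢ Data.Product.proj₂ a) arrows
    noRepeats : Unique arrows
    connected : ∀ x y → Reach arrows x y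

open StarredQuiver public

Arr : ∀ {n} → StarredQuiver n → Set
Arr Q = Fin (length (arrows Q))

Vec : ℕ → Set
Vec n = Fin n → ℚ

_≈v_ : ∀ {n} → Vec n → Vec n → Set
x ≈v y = ∀ i → x i ≡ y i

basis : ∀ {n} → Fin n → Vec n
basis j k with k ≟ j
... | yes _ = 1ℚ
... | no  _ = 0ℚ

zeroV : ∀ {n} → Vec n
zeroV _ = 0ℚ

uArrow : ∀ {n} → QArrow n → Vec n
uArrow (normal i , normal j) k = basis j k - basis i k
uArrow (star     , normal j)   = basis j
uArrow (normal i , star)     k = - basis i k
uArrow (star     , star)       = zeroV   -- never occurs (no loops)

u : ∀ {n} (Q : StarredQuiver n) → Arr Q → Vec n
u Q a = uArrow (lookup (arrows Q) a)

sumFin : ∀ {m} → (Fin m → ℚ) → ℚ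
sumFin {zero}  f = 0ℚ
sumFin {suc m} f = f zero + sumFin (λ i → f (suc i))

InConv : ∀ {m n} → (Fin m → Vec n) → Vec n → Set
InConv {m} p x = Σ (Fin m → ℚ) λ λs →
  (∀ i → 0ℚ ≤ λs i) × (sumFin λs ≡ 1ℚ) × (∀ k → x k ≡ sumFin (λ i → λs i * p i k))

Root : ∀ {n} (Q : StarredQuiver n) → Vec n → Set
Root Q = InConv (u Q)

IsVertex : ∀ {n} → (Vec n → Set) → Vec n → Set
IsVertex {n} P x = P x × (∀ (y z : Vec n) (t : ℚ) → P y → P z → 0ℚ < t → t < 1ℚ →
  (∀ k → x k ≡ t * y k + (1ℚ - t) * z k) → y ≈v z)

-- For an arrow β = (s → t) put W β = χ t − χ s, where χ vᵢ = eᵢ and χ ⋆ = −(1, …, 1). For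
-- α = (s′ → t′) the ⋆-contributions of χ cancel, leaving
--   ⟨W β, u_α⟩ = [t = t′] + [s = s′] − [t = s′] − [s = t′],
-- which is 2 for α = β and at most 1 otherwise. So the linear functional W β attains its maximum on
-- Root(Q) only at u_β: hence u_β is a vertex and differs from every other u_α. Conversely, a vertex x of
-- the convex hull of finitely many points pᵢ is one of them: if pᵢ has weight t ∈ (0, 1) in x, then
-- x = t pᵢ + (1 − t) z with z the renormalised combination of the other points, so pᵢ = z = x.
module Submission where

open import Defs
open import Data.Nat using (ℕ; zero; suc; _≤_)
open import Data.Fin using (Fin; zero; suc)
open import Data.Fin.Properties using (any?) renaming (_≟_ to _≟ᶠ_)
open import Data.Empty using (⊥-elim)
open import Data.Product using (Σ; ∃; _×_; _,_; proj₁; proj₂)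
open import Data.List using (List; length; lookup)
import Data.List.Relation.Unary.All as All
open import Data.List.Relation.Unary.AllPairs using (_∷_)
open import Data.List.Relation.Unary.Unique.Propositional using (Unique)
open import Data.List.Membership.Propositional.Properties using (∈-lookup)
open import Data.Vec.Functional using (updateAt)
open import Data.Vec.Functional.Properties using (updateAt-updates; updateAt-minimal)
open import Data.Rational
  using (ℚ; 0ℚ; 1ℚ; _+_; _*_; _-_; -_; 1/_; _<_; NonZero; positive; nonNegative)
  renaming (_≤_ to _≤ℚ_)
open import Data.Rational.Properties
open import Data.Rational.Solver using (module +-*-Solver)
open import Function using (const)
open import Relation.Nullary using (yes; no)
open import Relation.Nullary.Decidable using (map′)
open import Relation.Binary.Definitions using (DecidableEquality)
open import Relation.Binary.PropositionalEquality
  using (_≡_; _≢_; refl; sym; trans; cong; cong₂; subst; subst₂; module ≡-Reasoning)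

open +-*-Solver using (solve; _:=_; _:+_; _:-_; _:*_; con)

private
  variable
    m n : ℕ

*-nonneg : ∀ {p q} → 0ℚ ≤ℚ p → 0ℚ ≤ℚ q → 0ℚ ≤ℚ p * q
*-nonneg {p} {q} 0≤p 0≤q =
  nonNegative⁻¹ (p * q) {{nonNeg*nonNeg⇒nonNeg p {{nonNegative 0≤p}} q {{nonNegative 0≤q}}}}

p*q≡0⇒p≡0 : ∀ {p q} → 0ℚ < q → p * q ≡ 0ℚ → p ≡ 0ℚ
p*q≡0⇒p≡0 {p} {q} 0<q pq≡0 = ≤-antisym
  (*-cancelʳ-≤-pos q {{positive 0<q}} (subst (p * q ≤ℚ_) (sym (*-zeroˡ q)) (≤-reflexive pq≡0)))
  (*-cancelʳ-≤-pos q {{positive 0<q}} (subst (_≤ℚ p * q) (sym (*-zeroˡ q)) (≤-reflexive (sym pq≡0))))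

p+q≡0⇒p≡0 : ∀ {p q} → 0ℚ ≤ℚ p → 0ℚ ≤ℚ q → p + q ≡ 0ℚ → p ≡ 0ℚ
p+q≡0⇒p≡0 {p} {q} 0≤p 0≤q p+q≡0 = ≤-antisym
  (subst₂ _≤ℚ_ (+-identityʳ p) p+q≡0 (+-monoʳ-≤ p 0≤q)) 0≤p

p-q≤p : ∀ p {q} → 0ℚ ≤ℚ q → p - q ≤ℚ p
p-q≤p p {q} 0≤q = subst (p - q ≤ℚ_) (+-identityʳ p) (+-monoʳ-≤ p (neg-antimono-≤ 0≤q))

p<q⇒0<q-p : ∀ {p q} → p < q → 0ℚ < q - p
p<q⇒0<q-p {p} {q} p<q = subst (_< q - p) (+-inverseʳ p) (+-monoˡ-< (- p) p<q)

nonneg-combination≡0 : ∀ {s t p q} → 0ℚ < s → 0ℚ < t → 0ℚ ≤ℚ p → 0ℚ ≤ℚ q →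
  s * p + t * q ≡ 0ℚ → p ≡ 0ℚ × q ≡ 0ℚ
nonneg-combination≡0 {s} {t} {p} {q} 0<s 0<t 0≤p 0≤q sp+tq≡0 =
  p*q≡0⇒p≡0 0<s (trans (*-comm p s) (p+q≡0⇒p≡0 sp≥0 tq≥0 sp+tq≡0)) ,
  p*q≡0⇒p≡0 0<t (trans (*-comm q t) (p+q≡0⇒p≡0 tq≥0 sp≥0 (trans (+-comm (t * q) (s * p)) sp+tq≡0)))
  where
  sp≥0 : 0ℚ ≤ℚ s * p
  sp≥0 = *-nonneg (<⇒≤ 0<s) 0≤p
  tq≥0 : 0ℚ ≤ℚ t * q
  tq≥0 = *-nonneg (<⇒≤ 0<t) 0≤q

sum-cong : {f g : Fin m → ℚ} → (∀ i → f i ≡ g i) → sumFin f ≡ sumFin g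
sum-cong {zero}  f≗g = refl
sum-cong {suc m} f≗g = cong₂ _+_ (f≗g zero) (sum-cong (λ i → f≗g (suc i)))

sum-zero : sumFin {m} (const 0ℚ) ≡ 0ℚ
sum-zero {zero}  = refl
sum-zero {suc m} = trans (+-identityˡ _) (sum-zero {m})

sum-+ : (f g : Fin m → ℚ) → sumFin (λ i → f i + g i) ≡ sumFin f + sumFin g
sum-+ {zero}  f g = refl
sum-+ {suc m} f g = trans (cong (f zero + g zero +_) (sum-+ (λ i → f (suc i)) (λ i → g (suc i))))
  (solve 4 (λ a b c d → (a :+ b) :+ (c :+ d) := (a :+ c) :+ (b :+ d)) refl (f zero) (g zero) _ _)

*-distribˡ-sum : ∀ c (f : Fin m → ℚ) → c * sumFin f ≡ sumFin (λ i → c * f i)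
*-distribˡ-sum {zero}  c f = *-zeroʳ c
*-distribˡ-sum {suc m} c f =
  trans (*-distribˡ-+ c (f zero) _) (cong (c * f zero +_) (*-distribˡ-sum c (λ i → f (suc i))))

sum-linear : ∀ s t (f g : Fin m → ℚ) →
  sumFin (λ i → s * f i + t * g i) ≡ s * sumFin f + t * sumFin g
sum-linear s t f g =
  trans (sum-+ (λ i → s * f i) (λ i → t * g i)) (sym (cong₂ _+_ (*-distribˡ-sum s f) (*-distribˡ-sum t g)))

sum-comm : (G : Fin m → Fin n → ℚ) →
  sumFin (λ i → sumFin (G i)) ≡ sumFin (λ k → sumFin (λ i → G i k))
sum-comm {zero}  {n} G = sym (sum-zero {n})
sum-comm {suc m} G =
  trans (cong (sumFin (G zero) +_) (sum-comm (λ i → G (suc i)))) (sym (sum-+ (G zero) _))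

sum-nonneg : {f : Fin m → ℚ} → (∀ i → 0ℚ ≤ℚ f i) → 0ℚ ≤ℚ sumFin f
sum-nonneg {zero}  f≥0 = ≤-refl
sum-nonneg {suc m} {f} f≥0 = subst (_≤ℚ sumFin f) (+-identityʳ 0ℚ)
  (+-mono-≤ (f≥0 zero) (sum-nonneg (λ i → f≥0 (suc i))))

_without_ : (Fin m → ℚ) → Fin m → Fin m → ℚ
f without i = updateAt f i (const 0ℚ)

without-≢ : ∀ (f : Fin m → ℚ) {i j} → j ≢ i → (f without i) j ≡ f j
without-≢ f {i} {j} j≢i = updateAt-minimal j i f j≢i

without-nonneg : {f : Fin m → ℚ} → (∀ i → 0ℚ ≤ℚ f i) → ∀ i j → 0ℚ ≤ℚ (f without i) j
without-nonneg {f = f} f≥0 i j with j ≟ᶠ i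
... | yes refl = ≤-reflexive (sym (updateAt-updates j f))
... | no j≢i   = subst (0ℚ ≤ℚ_) (sym (without-≢ f j≢i)) (f≥0 j)

without-* : ∀ (f g : Fin m → ℚ) i j → ((λ k → f k * g k) without i) j ≡ (f without i) j * g j
without-* f g i j with j ≟ᶠ i
... | yes refl = trans (updateAt-updates j _)
                   (sym (trans (cong (_* g j) (updateAt-updates j f)) (*-zeroˡ (g j))))
... | no j≢i   = trans (without-≢ _ j≢i) (cong (_* g j) (sym (without-≢ f j≢i)))

sum-split : ∀ i (f : Fin m → ℚ) → sumFin f ≡ f i + sumFin (f without i)
sum-split zero    f = cong (f zero +_) (sym (+-identityˡ _))
sum-split (suc i) f = trans (cong (f zero +_) (sum-split i (λ j → f (suc j))))
  (solve 3 (λ a b c → a :+ (b :+ c) := b :+ (a :+ c)) refl (f zero) (f (suc i)) _)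

sum-concentrated : ∀ i (f : Fin m → ℚ) → (∀ j → j ≢ i → f j ≡ 0ℚ) → sumFin f ≡ f i
sum-concentrated {m} i f f≡0 =
  trans (sum-split i f) (trans (cong (f i +_) (trans (sum-cong rest≡0) (sum-zero {m}))) (+-identityʳ _))
  where
  rest≡0 : ∀ j → (f without i) j ≡ 0ℚ
  rest≡0 j with j ≟ᶠ i
  ... | yes refl = updateAt-updates j f
  ... | no j≢i   = trans (without-≢ f j≢i) (f≡0 j j≢i)

nonneg-sum≡0 : {f : Fin m → ℚ} → (∀ i → 0ℚ ≤ℚ f i) → sumFin f ≡ 0ℚ → ∀ i → f i ≡ 0ℚ
nonneg-sum≡0 {f = f} f≥0 Σf≡0 i =
  p+q≡0⇒p≡0 (f≥0 i) (sum-nonneg (without-nonneg f≥0 i)) (trans (sym (sum-split i f)) Σf≡0)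

basis-self : ∀ (j : Fin n) → basis j j ≡ 1ℚ
basis-self j with j ≟ᶠ j
... | yes _   = refl
... | no j≢j = ⊥-elim (j≢j refl)

basis-≢ : ∀ (j : Fin n) {k} → k ≢ j → basis j k ≡ 0ℚ
basis-≢ j {k} k≢j with k ≟ᶠ j
... | yes k≡j = ⊥-elim (k≢j k≡j)
... | no _    = refl

basis-nonneg : ∀ (j k : Fin n) → 0ℚ ≤ℚ basis j k
basis-nonneg j k with k ≟ᶠ j
... | yes _ = <⇒≤ (positive⁻¹ 1ℚ)
... | no _  = ≤-refl

basis≤1 : ∀ (j k : Fin n) → basis j k ≤ℚ 1ℚ
basis≤1 j k with k ≟ᶠ j
... | yes _ = ≤-refl
... | no _  = <⇒≤ (positive⁻¹ 1ℚ)

dot : Vec n → Vec n → ℚ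
dot w x = sumFin (λ k → w k * x k)

dot-cong : ∀ (w : Vec n) {x y} → x ≈v y → dot w x ≡ dot w y
dot-cong w x≈y = sum-cong (λ k → cong (w k *_) (x≈y k))

dot-linear : ∀ (w : Vec n) s t y z → dot w (λ k → s * y k + t * z k) ≡ s * dot w y + t * dot w z
dot-linear w s t y z = trans
  (sum-cong (λ k → solve 5 (λ W S T Y Z → W :* (S :* Y :+ T :* Z) := S :* (W :* Y) :+ T :* (W :* Z))
                     refl (w k) s t (y k) (z k)))
  (sum-linear s t (λ k → w k * y k) (λ k → w k * z k))

dot-sub : ∀ (w x y : Vec n) → dot w (λ k → x k - y k) ≡ dot w x - dot w y
dot-sub w x y = begin
  dot w (λ k → x k - y k)               ≡⟨ dot-cong w (λ k → as-combination (x k) (y k)) ⟩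
  dot w (λ k → 1ℚ * x k + (- 1ℚ) * y k) ≡⟨ dot-linear w 1ℚ (- 1ℚ) x y ⟩
  1ℚ * dot w x + (- 1ℚ) * dot w y       ≡⟨ sym (as-combination (dot w x) (dot w y)) ⟩
  dot w x - dot w y                     ∎
  where
  open ≡-Reasoning
  as-combination : ∀ a b → a - b ≡ 1ℚ * a + (- 1ℚ) * b
  as-combination = solve 2 (λ a b → a :- b := con 1ℚ :* a :+ con (- 1ℚ) :* b) refl

dot-zeroʳ : ∀ (w : Vec n) → dot w zeroV ≡ 0ℚ
dot-zeroʳ {n} w = trans (sum-cong (λ k → *-zeroʳ (w k))) (sum-zero {n})

dot-basis : ∀ (w : Vec n) j → dot w (basis j) ≡ w j
dot-basis w j = trans
  (sum-concentrated j _ (λ k k≢j → trans (cong (w k *_) (basis-≢ j k≢j)) (*-zeroʳ (w k))))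
  (trans (cong (w j *_) (basis-self j)) (*-identityʳ (w j)))

dot-combination : ∀ (w : Vec n) (p : Fin m → Vec n) (ls : Fin m → ℚ) {x} →
  (∀ k → x k ≡ sumFin (λ i → ls i * p i k)) → dot w x ≡ sumFin (λ i → ls i * dot w (p i))
dot-combination w p ls {x} x≡ = begin
  dot w x
    ≡⟨ dot-cong w x≡ ⟩
  sumFin (λ k → w k * sumFin (λ i → ls i * p i k))
    ≡⟨ sum-cong (λ k → *-distribˡ-sum (w k) (λ i → ls i * p i k)) ⟩
  sumFin (λ k → sumFin (λ i → w k * (ls i * p i k)))
    ≡⟨ sum-comm (λ i k → w k * (ls i * p i k)) ⟨
  sumFin (λ i → sumFin (λ k → w k * (ls i * p i k)))
    ≡⟨ sum-cong (λ i → sum-cong (λ k → reorder (w k) (ls i) (p i k))) ⟩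
  sumFin (λ i → sumFin (λ k → ls i * (w k * p i k)))
    ≡⟨ sum-cong (λ i → *-distribˡ-sum (ls i) (λ k → w k * p i k)) ⟨
  sumFin (λ i → ls i * dot w (p i))
    ∎
  where
  open ≡-Reasoning
  reorder : ∀ a b c → a * (b * c) ≡ b * (a * c)
  reorder = solve 3 (λ a b c → a :* (b :* c) := b :* (a :* c)) refl

module _ (p : Fin m → Vec n) where

  combination-concentrated : ∀ {ls i} → sumFin ls ≡ 1ℚ → (∀ j → j ≢ i → ls j ≡ 0ℚ) →
    ∀ k → sumFin (λ j → ls j * p j k) ≡ p i k
  combination-concentrated {ls} {i} Σls≡1 ls≡0 k = begin
    sumFin (λ j → ls j * p j k) ≡⟨ sum-concentrated i _ terms≡0 ⟩
    ls i * p i k                ≡⟨ cong (_* p i k) (trans (sym (sum-concentrated i ls ls≡0)) Σls≡1) ⟩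
    1ℚ * p i k                  ≡⟨ *-identityˡ (p i k) ⟩
    p i k                       ∎
    where
    open ≡-Reasoning
    terms≡0 : ∀ j → j ≢ i → ls j * p j k ≡ 0ℚ
    terms≡0 j j≢i = trans (cong (_* p j k) (ls≡0 j j≢i)) (*-zeroˡ (p j k))

  point∈hull : ∀ i → InConv p (p i)
  point∈hull i = basis i , basis-nonneg i , Σbasis≡1 ,
    λ k → sym (combination-concentrated Σbasis≡1 (λ j → basis-≢ i) k)
    where
    Σbasis≡1 : sumFin (basis i) ≡ 1ℚ
    Σbasis≡1 = trans (sum-concentrated i (basis i) (λ j → basis-≢ i)) (basis-self i)

  slack-combination : ∀ (w : Vec n) c {ls x} → sumFin ls ≡ 1ℚ →
    (∀ k → x k ≡ sumFin (λ i → ls i * p i k)) →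
    c - dot w x ≡ sumFin (λ i → ls i * (c - dot w (p i)))
  slack-combination w c {ls} {x} Σls≡1 x≡ = sym (begin
    sumFin (λ i → ls i * (c - dot w (p i)))
      ≡⟨ sum-cong (λ i → expand (ls i) (dot w (p i))) ⟩
    sumFin (λ i → c * ls i + (- 1ℚ) * (ls i * dot w (p i)))
      ≡⟨ sum-linear c (- 1ℚ) ls (λ i → ls i * dot w (p i)) ⟩
    c * sumFin ls + (- 1ℚ) * sumFin (λ i → ls i * dot w (p i))
      ≡⟨ cong₂ (λ a b → c * a + (- 1ℚ) * b) Σls≡1 (sym (dot-combination w p ls x≡)) ⟩
    c * 1ℚ + (- 1ℚ) * dot w x
      ≡⟨ collapse (dot w x) ⟩
    c - dot w x
      ∎)
    where
    open ≡-Reasoning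
    expand : ∀ l d → l * (c - d) ≡ c * l + (- 1ℚ) * (l * d)
    expand = solve 3 (λ C l d → l :* (C :- d) := C :* l :+ con (- 1ℚ) :* (l :* d)) refl c
    collapse : ∀ d → c * 1ℚ + (- 1ℚ) * d ≡ c - d
    collapse = solve 2 (λ C d → C :* con 1ℚ :+ con (- 1ℚ) :* d := C :- d) refl c

Exposed : (Fin m → Vec n) → Fin m → Set
Exposed {n = n} p a = Σ (Vec n) λ w → ∀ i → i ≢ a → dot w (p i) < dot w (p a)

module _ (p : Fin m → Vec n) {a : Fin m} (exposed : Exposed p a) where

  private
    w : Vec n
    w = proj₁ exposed

    slack : Vec n → ℚ
    slack y = dot w (p a) - dot w y

    slack-point-pos : ∀ i → i ≢ a → 0ℚ < slack (p i)
    slack-point-pos i i≢a = p<q⇒0<q-p (proj₂ exposed i i≢a)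

    slack-point-nonneg : ∀ i → 0ℚ ≤ℚ slack (p i)
    slack-point-nonneg i with i ≟ᶠ a
    ... | yes refl = ≤-reflexive (sym (+-inverseʳ (dot w (p a))))
    ... | no i≢a   = <⇒≤ (slack-point-pos i i≢a)

    slack-hull-nonneg : ∀ {y} → InConv p y → 0ℚ ≤ℚ slack y
    slack-hull-nonneg (ls , ls≥0 , Σls≡1 , y≡) =
      subst (0ℚ ≤ℚ_) (sym (slack-combination p w (dot w (p a)) Σls≡1 y≡))
        (sum-nonneg (λ i → *-nonneg (ls≥0 i) (slack-point-nonneg i)))

    slack-hull-zero : ∀ {y} → InConv p y → slack y ≡ 0ℚ → y ≈v p a
    slack-hull-zero (ls , ls≥0 , Σls≡1 , y≡) slack≡0 k =
      trans (y≡ k) (combination-concentrated p Σls≡1 ls≡0 k)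
      where
      ls≡0 : ∀ j → j ≢ a → ls j ≡ 0ℚ
      ls≡0 j j≢a = p*q≡0⇒p≡0 (slack-point-pos j j≢a)
        (nonneg-sum≡0 (λ i → *-nonneg (ls≥0 i) (slack-point-nonneg i))
          (trans (sym (slack-combination p w (dot w (p a)) Σls≡1 y≡)) slack≡0) j)

    slack-split : ∀ y z t → p a ≈v (λ k → t * y k + (1ℚ - t) * z k) →
      t * slack y + (1ℚ - t) * slack z ≡ 0ℚ
    slack-split y z t pa≈ = begin
      t * (c - dot w y) + (1ℚ - t) * (c - dot w z) ≡⟨ regroup t (dot w y) (dot w z) ⟩
      c - (t * dot w y + (1ℚ - t) * dot w z)     ≡⟨ cong (_-_ c) (sym c≡) ⟩
      c - c                                       ≡⟨ +-inverseʳ c ⟩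
      0ℚ                                          ∎
      where
      open ≡-Reasoning
      c : ℚ
      c = dot w (p a)
      regroup : ∀ t Y Z → t * (c - Y) + (1ℚ - t) * (c - Z) ≡ c - (t * Y + (1ℚ - t) * Z)
      regroup = solve 4 (λ C t Y Z → t :* (C :- Y) :+ (con 1ℚ :- t) :* (C :- Z)
                                    := C :- (t :* Y :+ (con 1ℚ :- t) :* Z)) refl c
      c≡ : c ≡ t * dot w y + (1ℚ - t) * dot w z
      c≡ = trans (dot-cong w pa≈) (dot-linear w t (1ℚ - t) y z)

  exposed⇒vertex : IsVertex (InConv p) (p a)
  exposed⇒vertex = point∈hull p a , extreme
    where
    extreme : ∀ y z t → InConv p y → InConv p z → 0ℚ < t → t < 1ℚ →
      (∀ k → p a k ≡ t * y k + (1ℚ - t) * z k) → y ≈v z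
    extreme y z t y∈ z∈ 0<t t<1 pa≈ k =
      trans (slack-hull-zero y∈ (proj₁ slacks≡0) k) (sym (slack-hull-zero z∈ (proj₂ slacks≡0) k))
      where
      slacks≡0 : slack y ≡ 0ℚ × slack z ≡ 0ℚ
      slacks≡0 = nonneg-combination≡0 0<t (p<q⇒0<q-p t<1)
        (slack-hull-nonneg y∈) (slack-hull-nonneg z∈) (slack-split y z t pa≈)

  exposed-unique : ∀ b → p b ≈v p a → b ≡ a
  exposed-unique b pb≈pa with b ≟ᶠ a
  ... | yes b≡a = b≡a
  ... | no b≢a  = ⊥-elim (<-irrefl (dot-cong w pb≈pa) (proj₂ exposed b b≢a))

positive-weight : ∀ {ls : Fin m → ℚ} → (∀ i → 0ℚ ≤ℚ ls i) → sumFin ls ≡ 1ℚ → ∃ λ i → 0ℚ < ls i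
positive-weight {m} {ls} ls≥0 Σls≡1 with any? (λ i → 0ℚ <? ls i)
... | yes found = found
... | no none   = ⊥-elim (1≢0 (trans (sym Σls≡1) (trans (sum-cong ls≡0) (sum-zero {m}))))
  where
  ls≡0 : ∀ i → ls i ≡ 0ℚ
  ls≡0 i = ≤-antisym (≮⇒≥ (λ 0<ls-i → none (i , 0<ls-i))) (ls≥0 i)

module _ (p : Fin m → Vec n) {ls : Fin m → ℚ} (ls≥0 : ∀ i → 0ℚ ≤ℚ ls i)
         (i : Fin m) (0<r : 0ℚ < sumFin (ls without i)) where

  private
    r : ℚ
    r = sumFin (ls without i)

    instance
      r≢0 : NonZero r
      r≢0 = pos⇒nonZero r {{positive 0<r}}

    μ : Fin m → ℚ
    μ j = 1/ r * (ls without i) j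

    cancel : ∀ a b → r * ((1/ r * a) * b) ≡ a * b
    cancel a b = trans (solve 4 (λ R S A B → R :* ((S :* A) :* B) := (R :* S) :* (A :* B)) refl r (1/ r) a b)
      (trans (cong (_* (a * b)) (*-inverseʳ r)) (*-identityˡ (a * b)))

  rest-point : Vec n
  rest-point k = sumFin (λ j → μ j * p j k)

  rest-point∈hull : InConv p rest-point
  rest-point∈hull = μ , μ≥0 , Σμ≡1 , λ k → refl
    where
    μ≥0 : ∀ j → 0ℚ ≤ℚ μ j
    μ≥0 j = *-nonneg (nonNegative⁻¹ (1/ r) {{pos⇒nonNeg (1/ r) {{1/pos⇒pos r {{positive 0<r}}}}}})
                     (without-nonneg ls≥0 i j)
    Σμ≡1 : sumFin μ ≡ 1ℚ
    Σμ≡1 = trans (sym (*-distribˡ-sum (1/ r) (ls without i))) (*-inverseˡ r)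

  combination-split : ∀ k → sumFin (λ j → ls j * p j k) ≡ ls i * p i k + sumFin (ls without i) * rest-point k
  combination-split k = trans (sum-split i (λ j → ls j * p j k)) (cong (ls i * p i k +_) (begin
    sumFin ((λ j → ls j * p j k) without i) ≡⟨ sum-cong (without-* ls (λ j → p j k) i) ⟩
    sumFin (λ j → (ls without i) j * p j k) ≡⟨ sum-cong (λ j → cancel ((ls without i) j) (p j k)) ⟨
    sumFin (λ j → r * (μ j * p j k))        ≡⟨ sym (*-distribˡ-sum r (λ j → μ j * p j k)) ⟩
    r * rest-point k                        ∎))
    where open ≡-Reasoning

vertex⇒point : ∀ (p : Fin m → Vec n) {x} → IsVertex (InConv p) x → ∃ λ i → x ≈v p i
vertex⇒point {n = n} p {x} ((ls , ls≥0 , Σls≡1 , x≡) , extreme) with positive-weight ls≥0 Σls≡1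
... | i , 0<t with 0ℚ <? sumFin (ls without i)
...   | no  0≮r = i , λ k → trans (x≡ k) (combination-concentrated p Σls≡1 ls≡0 k)
  where
  ls≡0 : ∀ j → j ≢ i → ls j ≡ 0ℚ
  ls≡0 j j≢i = trans (sym (without-≢ ls j≢i)) (nonneg-sum≡0 (without-nonneg ls≥0 i) rest≡0 j)
    where
    rest≡0 : sumFin (ls without i) ≡ 0ℚ
    rest≡0 = ≤-antisym (≮⇒≥ 0≮r) (sum-nonneg (without-nonneg ls≥0 i))
...   | yes 0<r = i , λ k → begin
  x k                    ≡⟨ x≡split k ⟩
  t * p i k + r * z k    ≡⟨ cong (λ v → t * p i k + r * v) (sym (pi≈z k)) ⟩
  t * p i k + r * p i k  ≡⟨ sym (*-distribʳ-+ (p i k) t r) ⟩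
  (t + r) * p i k        ≡⟨ cong (_* p i k) t+r≡1 ⟩
  1ℚ * p i k             ≡⟨ *-identityˡ (p i k) ⟩
  p i k                  ∎
  where
  open ≡-Reasoning
  t r : ℚ
  t = ls i
  r = sumFin (ls without i)
  z : Vec n
  z = rest-point p ls≥0 i 0<r
  x≡split : ∀ k → x k ≡ t * p i k + r * z k
  x≡split k = trans (x≡ k) (combination-split p ls≥0 i 0<r k)
  t+r≡1 : t + r ≡ 1ℚ
  t+r≡1 = trans (sym (sum-split i ls)) Σls≡1
  r≡1-t : r ≡ 1ℚ - t
  r≡1-t = trans (solve 2 (λ T R → R := (T :+ R) :- T) refl t r) (cong (_- t) t+r≡1)
  t<1 : t < 1ℚ
  t<1 = subst₂ _<_ (+-identityʳ t) t+r≡1 (+-monoʳ-< t 0<r)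
  pi≈z : p i ≈v z
  pi≈z = extreme (p i) z t (point∈hull p i) (rest-point∈hull p ls≥0 i 0<r) 0<t t<1
    (λ k → trans (x≡split k) (cong (λ v → t * p i k + v * z k) r≡1-t))

normal-injective : ∀ {i j : Fin n} → normal i ≡ normal j → i ≡ j
normal-injective refl = refl

_≟ᵥ_ : DecidableEquality (QVertex n)
normal i ≟ᵥ normal j = map′ (cong normal) normal-injective (i ≟ᶠ j)
normal _ ≟ᵥ star     = no λ ()
star     ≟ᵥ normal _ = no λ ()
star     ≟ᵥ star     = yes refl

δ : QVertex n → QVertex n → ℚ
δ (normal i) (normal j) = basis i j
δ star       star       = 1ℚ
δ _          _          = 0ℚ

δ-refl : ∀ (x : QVertex n) → δ x x ≡ 1ℚ
δ-refl (normal i) = basis-self i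
δ-refl star       = refl

δ-≢ : ∀ {x y : QVertex n} → x ≢ y → δ x y ≡ 0ℚ
δ-≢ {x = normal i} {normal j} x≢y = basis-≢ i (λ j≡i → x≢y (cong normal (sym j≡i)))
δ-≢ {x = normal i} {star}     x≢y = refl
δ-≢ {x = star}     {normal j} x≢y = refl
δ-≢ {x = star}     {star}     x≢y = ⊥-elim (x≢y refl)

δ-nonneg : ∀ (x y : QVertex n) → 0ℚ ≤ℚ δ x y
δ-nonneg (normal i) (normal j) = basis-nonneg i j
δ-nonneg (normal i) star       = ≤-refl
δ-nonneg star       (normal j) = ≤-refl
δ-nonneg star       star       = <⇒≤ (positive⁻¹ 1ℚ)

δ≤1 : ∀ (x y : QVertex n) → δ x y ≤ℚ 1ℚ
δ≤1 (normal i) (normal j) = basis≤1 i j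
δ≤1 (normal i) star       = <⇒≤ (positive⁻¹ 1ℚ)
δ≤1 star       (normal j) = <⇒≤ (positive⁻¹ 1ℚ)
δ≤1 star       star       = ≤-refl

_at_ : Vec n → QVertex n → ℚ
w at normal i = w i
w at star     = 0ℚ

dot-uArrow : ∀ (w : Vec n) s t → dot w (uArrow (s , t)) ≡ w at t - w at s
dot-uArrow w (normal i) (normal j) =
  trans (dot-sub w (basis j) (basis i)) (cong₂ _-_ (dot-basis w j) (dot-basis w i))
dot-uArrow w star       (normal j) = trans (dot-basis w j) (sym (+-identityʳ (w j)))
dot-uArrow w (normal i) star       = begin
  dot w (λ k → - basis i k)         ≡⟨ dot-cong w (λ k → sym (+-identityˡ (- basis i k))) ⟩
  dot w (λ k → 0ℚ - basis i k)      ≡⟨ dot-sub w zeroV (basis i) ⟩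
  dot w zeroV - dot w (basis i)     ≡⟨ cong₂ _-_ (dot-zeroʳ w) (dot-basis w i) ⟩
  0ℚ - w i                          ∎
  where open ≡-Reasoning
dot-uArrow w star       star       = dot-zeroʳ w

χ : QVertex n → Vec n
χ (normal i) = basis i
χ star       = const (- 1ℚ)

χ-at : ∀ (x y : QVertex n) → χ x at y ≡ δ x y - δ x star
χ-at (normal i) (normal j) = sym (+-identityʳ (basis i j))
χ-at (normal i) star       = refl
χ-at star       (normal j) = refl
χ-at star       star       = refl

W : QArrow n → Vec n
W (s , t) k = χ t k - χ s k

W-at : ∀ (s t y : QVertex n) → W (s , t) at y ≡ χ t at y - χ s at y
W-at s t (normal j) = refl
W-at s t star       = refl

score : QArrow n → QArrow n → ℚ
score (s , t) (s′ , t′) = (δ t t′ + δ s s′) - (δ t s′ + δ s t′)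

dot-W-uArrow : ∀ (β α : QArrow n) → dot (W β) (uArrow α) ≡ score β α
dot-W-uArrow (s , t) (s′ , t′) = begin
  dot (W (s , t)) (uArrow (s′ , t′))
    ≡⟨ dot-uArrow (W (s , t)) s′ t′ ⟩
  W (s , t) at t′ - W (s , t) at s′
    ≡⟨ cong₂ _-_ (W-at s t t′) (W-at s t s′) ⟩
  (χ t at t′ - χ s at t′) - (χ t at s′ - χ s at s′)
    ≡⟨ cong₂ _-_ (cong₂ _-_ (χ-at t t′) (χ-at s t′)) (cong₂ _-_ (χ-at t s′) (χ-at s s′)) ⟩
  ((δ t t′ - δ t star) - (δ s t′ - δ s star)) - ((δ t s′ - δ t star) - (δ s s′ - δ s star))
    ≡⟨ cancel-star (δ t t′) (δ s t′) (δ t s′) (δ s s′) (δ t star) (δ s star) ⟩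
  score (s , t) (s′ , t′)
    ∎
  where
  open ≡-Reasoning
  cancel-star : ∀ a b c d e f → ((a - e) - (b - f)) - ((c - e) - (d - f)) ≡ (a + d) - (c + b)
  cancel-star = solve 6 (λ a b c d e f → ((a :- e) :- (b :- f)) :- ((c :- e) :- (d :- f))
                                        := (a :+ d) :- (c :+ b)) refl

score-self : ∀ {s t : QVertex n} → s ≢ t → score (s , t) (s , t) ≡ 1ℚ + 1ℚ
score-self {s = s} {t} s≢t
  rewrite δ-refl s | δ-refl t | δ-≢ s≢t | δ-≢ (λ t≡s → s≢t (sym t≡s)) = refl

score<2 : ∀ {α β : QArrow n} → α ≢ β → score β α < 1ℚ + 1ℚ
score<2 {α = s′ , t′} {s , t} α≢β =
  ≤-<-trans (p-q≤p _ (+-mono-≤ (δ-nonneg t s′) (δ-nonneg s t′)))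
    (≤-<-trans matches≤1 (+-monoʳ-< 1ℚ (positive⁻¹ 1ℚ)))
  where
  matches≤1 : δ t t′ + δ s s′ ≤ℚ 1ℚ
  matches≤1 with t ≟ᵥ t′ | s ≟ᵥ s′
  ... | yes refl | yes refl = ⊥-elim (α≢β refl)
  ... | no t≢t′  | _        rewrite δ-≢ t≢t′ = subst (_≤ℚ 1ℚ) (sym (+-identityˡ (δ s s′))) (δ≤1 s s′)
  ... | yes _    | no s≢s′  rewrite δ-≢ s≢s′ = subst (_≤ℚ 1ℚ) (sym (+-identityʳ (δ t t′))) (δ≤1 t t′)

score-max : ∀ {α β : QArrow n} → proj₁ β ≢ proj₂ β → α ≢ β → score β α < score β β
score-max {α = α} {β = s , t} s≢t α≢β = subst (score (s , t) α <_) (sym (score-self s≢t)) (score<2 α≢β)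

lookup-injective : ∀ {A : Set} {xs : List A} → Unique xs →
  ∀ {i j : Fin (length xs)} → lookup xs i ≡ lookup xs j → i ≡ j
lookup-injective (_ ∷ _) {zero}  {zero}  _ = refl
lookup-injective (x∉ ∷ _) {zero}  {suc j} x≡ = ⊥-elim (All.lookup x∉ (∈-lookup j) x≡)
lookup-injective (x∉ ∷ _) {suc i} {zero}  ≡x = ⊥-elim (All.lookup x∉ (∈-lookup i) (sym ≡x))
lookup-injective (_ ∷ xs!) {suc i} {suc j} eq = cong suc (lookup-injective xs! eq)

module _ (Q : StarredQuiver n) where

  arrow : Arr Q → QArrow n
  arrow = lookup (arrows Q)

  u-exposed : ∀ a → Exposed (u Q) a
  u-exposed a = W (arrow a) , λ b b≢a →
    subst₂ _<_ (sym (dot-W-uArrow (arrow a) (arrow b))) (sym (dot-W-uArrow (arrow a) (arrow a)))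
      (score-max (All.lookup (noLoops Q) (∈-lookup a))
                 (λ arrow-b≡arrow-a → b≢a (lookup-injective (noRepeats Q) arrow-b≡arrow-a)))

lemma2p10 : (n : ℕ) → 1 ≤ n → (Q : StarredQuiver n) →
    ((a : Arr Q) → IsVertex (Root Q) (u Q a))
    × ((a b : Arr Q) → u Q a ≈v u Q b → a ≡ b)
    × ((x : Vec n) → IsVertex (Root Q) x → ∃ λ (a : Arr Q) → x ≈v u Q a)
lemma2p10 n _ Q =
    (λ a → exposed⇒vertex (u Q) (u-exposed Q a))
  , (λ a b ua≈ub → exposed-unique (u Q) (u-exposed Q b) a ua≈ub)
  , (λ x → vertex⇒point (u Q))
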